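{- For positive integers $n_1,\ldots,n_d$, $$\sum_{\pi \in \mathcal{P}(n_1,\ldots, n_d, \infty)} t^{\mathrm{cor}(\pi)} q^{|\pi|_{ch}} = \prod_{i_1 = 1}^{n_1} \cdots \prod_{i_d = 1}^{n_d} \left( 1 - t q^{i_1 + \cdots + i_d - d + 1} \right)^{ -1}.$$
   Context: A $d$-dimensional partition is an array $\pi=(\pi_{\mathbf{i}})_{\mathbf{i}\in\mathbb{Z}_+^d}$ of nonnegative integers with finitely many nonzero entries, weakly decreasing in each coordinate. $D(\pi)=\{(i_1,\ldots,i_d,i)\in\mathbb{Z}_+^{d+1}:1\le i\le\pi_{i_1,\ldots,i_d}\}$; $\mathcal{P}(n_1,\ldots,n_d,\infty)$ is the set of those with $D(\pi)\subseteq[n_1]\times\cdots\times[n_d]\times\mathbb{Z}_+$. $\mathrm{Cor}(\pi)=\{\mathbf{i}\in D(\pi):\mathbf{i}+\mathbf{e}_\ell\notin D(\pi)\ \forall\ell\in[d]\}$, $\mathrm{cor}(\pi)=|\mathrm{Cor}(\pi)|$. For $\mathbf{i}=(i_1,\ldots,i_d)$, $\mathrm{ch}(\mathbf{i})=i_1+\cdots+i_d-d+1$, and $|\pi|_{ch}=\sum_{(\mathbf{i},i_{d+1})\in\mathrm{Cor}(\pi)}\mathrm{ch}(\mathbf{i})$. -}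

module Defs where

open import Data.Nat using (ℕ; zero; suc; _+_; _*_; _∸_; _≤_; _<_; _<?_)
open import Data.Nat.Properties using (_≟_)
open import Data.Fin using (Fin; zero; suc; toℕ)
open import Data.Fin.Properties using (all?)
open import Data.Vec using (Vec; []; _∷_)
open import Data.Nat.ListAction using (sum)
open import Data.List using (List; []; _∷_; map; length; filter; upTo; allFin; concatMap)
open import Data.Maybe using (Maybe; just; nothing)
import Data.Maybe as Maybe
open import Data.Product using (_×_; _,_)
open import Data.Unit using (⊤; tt)
open import Relation.Nullary using (yes; no)

-- An element of P(n₁,…,n_d,∞) is determined by its entries inside the box
-- (entries outside the box are 0), i.e. by a d-dimensional array of naturals.
Array : ∀ {d} → Vec ℕ d → Set
Array [] = ℕ
Array (n ∷ ns) = Vec (Array ns) n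

-- Positions in the box; coordinate value (toℕ i + 1) ∈ [n], i.e. 1-based.
Idx : ∀ {d} → Vec ℕ d → Set
Idx [] = ⊤
Idx (n ∷ ns) = Fin n × Idx ns

get : ∀ {d} {ns : Vec ℕ d} → Array ns → Idx ns → ℕ
get {ns = []} x tt = x
get {ns = n ∷ ns} xs (i , is) = get (Data.Vec.lookup xs i) is

allIdx : ∀ {d} (ns : Vec ℕ d) → List (Idx ns)
allIdx [] = tt ∷ []
allIdx (n ∷ ns) = concatMap (λ i → map (λ is → i , is) (allIdx ns)) (allFin n)

_≤ᵢ_ : ∀ {d} {ns : Vec ℕ d} → Idx ns → Idx ns → Set
_≤ᵢ_ {ns = []} _ _ = ⊤
_≤ᵢ_ {ns = n ∷ ns} (i , is) (j , js) = (toℕ i ≤ toℕ j) × (is ≤ᵢ js)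

IsPartition : ∀ {d} {ns : Vec ℕ d} → Array ns → Set
IsPartition {ns = ns} π = (i j : Idx ns) → i ≤ᵢ j → get π j ≤ get π i

nextFin : ∀ {n} → Fin n → Maybe (Fin n)
nextFin {suc zero} zero = nothing
nextFin {suc (suc n)} zero = just (suc zero)
nextFin {suc (suc n)} (suc i) = Maybe.map suc (nextFin i)

step : ∀ {d} {ns : Vec ℕ d} → Fin d → Idx ns → Maybe (Idx ns)
step {ns = n ∷ ns} zero (i , is) = Maybe.map (λ j → j , is) (nextFin i)
step {ns = n ∷ ns} (suc ℓ) (i , is) = Maybe.map (λ js → i , js) (step ℓ is)

getM : ∀ {d} {ns : Vec ℕ d} → Array ns → Maybe (Idx ns) → ℕ
getM π (just i) = get π i
getM π nothing = 0

-- number of k ∈ [1, π_i] with (i,k) ∈ Cor(π), i.e. (i + e_ℓ, k) ∉ D(π) for all ℓ ∈ [d]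
cornersAt : ∀ {d} {ns : Vec ℕ d} → Array ns → Idx ns → ℕ
cornersAt {d} π i =
  length (filter (λ k → all? (λ ℓ → getM π (step ℓ i) <? k))
                 (map suc (upTo (get π i))))

coordSum : ∀ {d} {ns : Vec ℕ d} → Idx ns → ℕ
coordSum {ns = []} tt = 0
coordSum {ns = n ∷ ns} (i , is) = suc (toℕ i) + coordSum is

ch : ∀ {d} {ns : Vec ℕ d} → Idx ns → ℕ
ch {d} i = coordSum i ∸ d + 1

cor : ∀ {d} {ns : Vec ℕ d} → Array ns → ℕ
cor {ns = ns} π = sum (map (cornersAt π) (allIdx ns))

chWeight : ∀ {d} {ns : Vec ℕ d} → Array ns → ℕ
chWeight {ns = ns} π = sum (map (λ i → ch i * cornersAt π i) (allIdx ns))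

-- Formal power series in t, q with ℕ coefficients: S a b = coefficient of t^a q^b.
FPS : Set
FPS = ℕ → ℕ → ℕ

oneS : FPS
oneS zero zero = 1
oneS _ _ = 0

_⊛_ : FPS → FPS → FPS
(f ⊛ g) a b = sum (map (λ a₁ → sum (map (λ b₁ → f a₁ b₁ * g (a ∸ a₁) (b ∸ b₁))
                                       (upTo (suc b))))
                       (upTo (suc a)))

-- (1 − t q^c)^{-1} = Σ_{k ≥ 0} t^k q^{k c}
geomInv : ℕ → FPS
geomInv c a b with b ≟ a * c
... | yes _ = 1
... | no _ = 0

prodS : List FPS → FPS
prodS [] = oneS
prodS (f ∷ fs) = f ⊛ prodS fs

rhsSeries : ∀ {d} (ns : Vec ℕ d) → FPS
rhsSeries ns = prodS (map (λ i → geomInv (ch i)) (allIdx ns))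

module Submission where

open import Defs
open import Data.Nat using (ℕ; _≤_)
open import Data.Fin using (Fin)
open import Data.Vec using (Vec; lookup)
open import Data.List using (List; length)
open import Data.List.Membership.Propositional using (_∈_)
open import Data.List.Relation.Unary.Unique.Propositional using (Unique)
open import Data.Product using (Σ; _×_)
open import Function.Bundles using (_⇔_)
open import Relation.Binary.PropositionalEquality using (_≡_)

open import Data.Nat using (zero; suc; _+_; _*_; _∸_; _<_; _<?_; _⊔_; _⊓_; z≤n; s≤s; s≤s⁻¹)
open import Data.Nat.Properties
open import Data.Nat.ListAction using (sum)
open import Data.Fin using (zero; suc; toℕ)
open import Data.Fin.Properties using (all?)
open import Data.Vec using ([]; _∷_)
import Data.Vec as Vec
import Data.Vec.Properties as Vec
open import Data.List using ([]; _∷_; [_]; _++_; _∷ʳ_; map; filter; upTo; allFin; concat; concatMap; take; drop; tabulate)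
open import Data.List.Properties
  using (map-∘; map-++; map-cong; map-concatMap; map-tabulate; length-map; length-++;
         length-take; length-drop; length-tabulate; take++drop≡id; upTo-∷ʳ; filter-++; filter-accept; filter-reject;
         ∷-injectiveˡ; ∷-injectiveʳ)
open import Data.List.Membership.Propositional.Properties using (∈-map⁺; ∈-map⁻; ∈-++⁺ˡ; ∈-++⁺ʳ; ∈-++⁻; ∈-upTo⁺; ∈-upTo⁻; ∈-allFin)
open import Data.List.Relation.Unary.Any using (here; there)
open import Data.List.Relation.Unary.AllPairs using ([]; _∷_)
import Data.List.Relation.Unary.All as All
import Data.List.Relation.Unary.All.Properties as All
import Data.List.Relation.Unary.Unique.Propositional.Properties as Unique
open import Data.Maybe using (just; nothing; maybe′)
import Data.Maybe as Maybe
open import Data.Product using (_,_; proj₁; proj₂; ∃)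
open import Data.Sum using (inj₁; inj₂)
open import Data.Unit using (tt)
open import Data.Empty using (⊥-elim)
open import Relation.Nullary using (yes; no; Dec; ¬_)
open import Relation.Binary.PropositionalEquality using (refl; sym; trans; cong; cong₂; subst; subst₂; module ≡-Reasoning)
open import Function using (_∘_)
open import Function.Bundles using (mk⇔; Equivalence)

-- A partition π in the box is determined by its corner counts
-- m_i = #{k : (i, k) ∈ Cor π}, because π_i = m_i + max_ℓ π_{i+e_ℓ} (the maximum
-- over the neighbours of i inside the box, 0 if there are none).  Conversely,
-- for every m : box → ℕ this recursion has exactly one solution, by descending
-- induction towards the far corner of the box, and that solution is weakly
-- decreasing, i.e. a partition with corner counts m.  Under this bijection
-- cor π = Σ m_i and |π|_ch = Σ ch(i) m_i, so the partitions counted by the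
-- coefficient of t^a q^b correspond to the tuples (m_i) with Σ m_i = a and
-- Σ ch(i) m_i = b, which are what that coefficient of ∏_i Σ_k t^k q^{k ch(i)} counts.

length-concatMap : ∀ {A B : Set} (f : A → List B) (xs : List A) →
  length (concatMap f xs) ≡ sum (map (length ∘ f) xs)
length-concatMap f [] = refl
length-concatMap f (x ∷ xs) =
  trans (length-++ (f x)) (cong (length (f x) +_) (length-concatMap f xs))

sum-map-const : ∀ {A : Set} (s : ℕ) (xs : List A) → sum (map (λ _ → s) xs) ≡ length xs * s
sum-map-const s [] = refl
sum-map-const s (x ∷ xs) = cong (s +_) (sum-map-const s xs)

∈-concatMap⁻ : ∀ {A B : Set} (f : A → List B) (xs : List A) {z} →
  z ∈ concatMap f xs → ∃ λ x → x ∈ xs × z ∈ f x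
∈-concatMap⁻ f (x ∷ xs) p with ∈-++⁻ (f x) p
... | inj₁ q = x , here refl , q
... | inj₂ q with ∈-concatMap⁻ f xs q
... | y , y∈ , r = y , there y∈ , r

∈-concatMap⁺ : ∀ {A B : Set} (f : A → List B) {xs : List A} {x z} →
  x ∈ xs → z ∈ f x → z ∈ concatMap f xs
∈-concatMap⁺ f (here refl) q = ∈-++⁺ˡ q
∈-concatMap⁺ f {y ∷ _} (there p) q = ∈-++⁺ʳ (f y) (∈-concatMap⁺ f p q)

Unique-concatMap⁺ : ∀ {A B : Set} (f : A → List B) (xs : List A) →
  Unique xs → (∀ x → Unique (f x)) → (∀ x y z → z ∈ f x → z ∈ f y → x ≡ y) →
  Unique (concatMap f xs)
Unique-concatMap⁺ f [] _ _ _ = []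
Unique-concatMap⁺ f (x ∷ xs) (x∉ ∷ u) uf sep =
  Unique.++⁺ (uf x) (Unique-concatMap⁺ f xs u uf sep) disjoint
  where
  disjoint : ∀ {z} → ¬ (z ∈ f x × z ∈ concatMap f xs)
  disjoint (p , q) with ∈-concatMap⁻ f xs q
  ... | y , y∈ , r = All.lookup x∉ y∈ (sep x y _ p r)

Unique-map⁺-∈ : ∀ {A B : Set} (f : A → B) (xs : List A) → Unique xs →
  (∀ {x y} → x ∈ xs → y ∈ xs → f x ≡ f y → x ≡ y) → Unique (map f xs)
Unique-map⁺-∈ f [] _ _ = []
Unique-map⁺-∈ f (x ∷ xs) (x∉ ∷ u) inj =
  All.map⁺ (All.tabulate λ y∈ fx≡fy → All.lookup x∉ y∈ (inj (here refl) (there y∈) fx≡fy))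
  ∷ Unique-map⁺-∈ f xs u (λ p q → inj (there p) (there q))

map-≡⇒≡-∈ : ∀ {A B : Set} {f g : A → B} (xs : List A) {x} → map f xs ≡ map g xs → x ∈ xs → f x ≡ g x
map-≡⇒≡-∈ (y ∷ xs) eq (here refl) = ∷-injectiveˡ eq
map-≡⇒≡-∈ (y ∷ xs) eq (there p) = map-≡⇒≡-∈ xs (∷-injectiveʳ eq) p

module _ {A B : Set} {P : A → Set} {Q : B → Set} (f : A → B) (g : B → A)
         (g∘f : ∀ {x} → P x → g (f x) ≡ x) (f∘g : ∀ {y} → Q y → f (g y) ≡ y)
         (P⇒Q : ∀ {x} → P x → Q (f x)) (Q⇒P : ∀ {y} → Q y → P (g y)) where

  enumeration-map : (xs : List A) → Unique xs → (∀ x → x ∈ xs ⇔ P x) →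
    Unique (map f xs) × (∀ y → y ∈ map f xs ⇔ Q y)
  enumeration-map xs u xs⇔P = unique , (λ y → mk⇔ (to y) (from y))
    where
    P-∈ : ∀ {x} → x ∈ xs → P x
    P-∈ = Equivalence.to (xs⇔P _)
    unique : Unique (map f xs)
    unique = Unique-map⁺-∈ f xs u λ p q fx≡fy →
      trans (sym (g∘f (P-∈ p))) (trans (cong g fx≡fy) (g∘f (P-∈ q)))
    to : ∀ y → y ∈ map f xs → Q y
    to y p with ∈-map⁻ f p
    ... | x , x∈ , refl = P⇒Q (P-∈ x∈)
    from : ∀ y → Q y → y ∈ map f xs
    from y q = subst (_∈ map f xs) (f∘g q) (∈-map⁺ f (Equivalence.from (xs⇔P (g y)) (Q⇒P q)))

-- Counting solutions of Σ m = a, Σ c m = b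

dot : List ℕ → List ℕ → ℕ
dot (c ∷ cs) (m ∷ ms) = c * m + dot cs ms
dot _ _ = 0

dot-map : ∀ {A : Set} (c g : A → ℕ) xs → dot (map c xs) (map g xs) ≡ sum (map (λ i → c i * g i) xs)
dot-map c g [] = refl
dot-map c g (x ∷ xs) = cong (c x * g x +_) (dot-map c g xs)

IsSolution : List ℕ → ℕ → ℕ → List ℕ → Set
IsSolution cs a b m = length m ≡ length cs × sum m ≡ a × dot cs m ≡ b

when : ∀ {P A : Set} → Dec P → List A → List A
when (yes _) xs = xs
when (no _) _ = []

-- The enumeration follows the Cauchy products defining prodS (map geomInv cs).
solutions : List ℕ → ℕ → ℕ → List (List ℕ)
solutions [] zero zero = [] ∷ []
solutions [] _ _ = []
solutions (c ∷ cs) a b =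
  concatMap (λ a₁ → concatMap (λ b₁ → when (b₁ ≟ a₁ * c) (map (a₁ ∷_) (solutions cs (a ∸ a₁) (b ∸ b₁))))
                              (upTo (suc b)))
            (upTo (suc a))

length-when-geomInv : ∀ c a₁ b₁ {A : Set} (xs : List A) →
  length (when (b₁ ≟ a₁ * c) xs) ≡ geomInv c a₁ b₁ * length xs
length-when-geomInv c a₁ b₁ xs with b₁ ≟ a₁ * c
... | yes _ = sym (+-identityʳ (length xs))
... | no _ = refl

length-solutions : ∀ cs a b → length (solutions cs a b) ≡ prodS (map geomInv cs) a b
length-solutions [] zero zero = refl
length-solutions [] zero (suc b) = refl
length-solutions [] (suc a) b = refl
length-solutions (c ∷ cs) a b =
  begin
    length (solutions (c ∷ cs) a b)
  ≡⟨ length-concatMap (λ a₁ → concatMap (term a₁) (upTo (suc b))) (upTo (suc a)) ⟩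
    sum (map (λ a₁ → length (concatMap (term a₁) (upTo (suc b)))) (upTo (suc a)))
  ≡⟨ cong sum (map-cong (λ a₁ → length-concatMap (term a₁) (upTo (suc b))) (upTo (suc a))) ⟩
    sum (map (λ a₁ → sum (map (length ∘ term a₁) (upTo (suc b)))) (upTo (suc a)))
  ≡⟨ cong sum (map-cong (λ a₁ → cong sum (map-cong (length-term a₁) (upTo (suc b)))) (upTo (suc a))) ⟩
    prodS (map geomInv (c ∷ cs)) a b
  ∎
  where
  open ≡-Reasoning
  term : ℕ → ℕ → List (List ℕ)
  term a₁ b₁ = when (b₁ ≟ a₁ * c) (map (a₁ ∷_) (solutions cs (a ∸ a₁) (b ∸ b₁)))
  length-term : ∀ a₁ b₁ → length (term a₁ b₁) ≡ geomInv c a₁ b₁ * prodS (map geomInv cs) (a ∸ a₁) (b ∸ b₁)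
  length-term a₁ b₁ =
    trans (length-when-geomInv c a₁ b₁ _)
          (cong (geomInv c a₁ b₁ *_) (trans (length-map _ (solutions cs _ _)) (length-solutions cs _ _)))

∈-when⁻ : ∀ {c a₁ b₁ : ℕ} {xs : List (List ℕ)} {z : List ℕ} → z ∈ when (b₁ ≟ a₁ * c) (map (a₁ ∷_) xs) →
  b₁ ≡ a₁ * c × ∃ λ m → z ≡ a₁ ∷ m × m ∈ xs
∈-when⁻ {c} {a₁} {b₁} p with b₁ ≟ a₁ * c
∈-when⁻ p | yes e with ∈-map⁻ _ p
... | m , m∈ , z≡ = e , m , z≡ , m∈
∈-when⁻ () | no _

∈-when⁺ : ∀ {c a₁ : ℕ} {xs : List (List ℕ)} {m : List ℕ} → m ∈ xs → (a₁ ∷ m) ∈ when (a₁ * c ≟ a₁ * c) (map (a₁ ∷_) xs)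
∈-when⁺ {c} {a₁} p with a₁ * c ≟ a₁ * c
... | yes _ = ∈-map⁺ _ p
... | no ≢ = ⊥-elim (≢ refl)

∈-solutions⁻ : ∀ cs a b {m} → m ∈ solutions cs a b → IsSolution cs a b m
∈-solutions⁻ [] zero zero (here refl) = refl , refl , refl
∈-solutions⁻ (c ∷ cs) a b p with ∈-concatMap⁻ _ (upTo (suc a)) p
... | a₁ , a₁∈ , q with ∈-concatMap⁻ _ (upTo (suc b)) q
... | b₁ , b₁∈ , r with ∈-when⁻ {c} {a₁} {b₁} r
... | b₁≡ , m , refl , m∈ with ∈-solutions⁻ cs (a ∸ a₁) (b ∸ b₁) m∈
... | len , s , dt =
  cong suc len ,
  trans (cong (a₁ +_) s) (m+[n∸m]≡n (s≤s⁻¹ (∈-upTo⁻ a₁∈))) ,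
  trans (cong₂ _+_ (trans (*-comm c a₁) (sym b₁≡)) dt) (m+[n∸m]≡n (s≤s⁻¹ (∈-upTo⁻ b₁∈)))

∈-solutions⁺ : ∀ cs a b {m} → IsSolution cs a b m → m ∈ solutions cs a b
∈-solutions⁺ [] zero zero {[]} _ = here refl
∈-solutions⁺ (c ∷ cs) _ _ {a₁ ∷ m} (len , refl , refl) =
  ∈-concatMap⁺ _ (∈-upTo⁺ (s≤s (m≤m+n a₁ (sum m))))
    (∈-concatMap⁺ _ (∈-upTo⁺ (s≤s (subst (_≤ c * a₁ + dot cs m) (*-comm c a₁) (m≤m+n (c * a₁) (dot cs m)))))
      (subst (λ b′ → (a₁ ∷ m) ∈ when (a₁ * c ≟ a₁ * c) (map (a₁ ∷_) (solutions cs (a₁ + sum m ∸ a₁) b′)))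
             (cong (c * a₁ + dot cs m ∸_) (*-comm c a₁))
        (∈-when⁺ (∈-solutions⁺ cs _ _ {m}
          (suc-injective len , sym (m+n∸m≡n a₁ (sum m)) , sym (m+n∸m≡n (c * a₁) (dot cs m)))))))

∈-solutions : ∀ cs a b m → m ∈ solutions cs a b ⇔ IsSolution cs a b m
∈-solutions cs a b m = mk⇔ (∈-solutions⁻ cs a b) (∈-solutions⁺ cs a b)

solutions-unique : ∀ cs a b → Unique (solutions cs a b)
solutions-unique [] zero zero = All.[] ∷ []
solutions-unique [] zero (suc b) = []
solutions-unique [] (suc a) b = []
solutions-unique (c ∷ cs) a b =
  Unique-concatMap⁺ _ (upTo (suc a)) (Unique.upTo⁺ (suc a))
    (λ a₁ → Unique-concatMap⁺ _ (upTo (suc b)) (Unique.upTo⁺ (suc b)) (unique-when a₁)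
       (λ b₁ b₁′ _ p q → trans (proj₁ (∈-when⁻ {c} {a₁} {b₁} p)) (sym (proj₁ (∈-when⁻ {c} {a₁} {b₁′} q)))))
    separated
  where
  unique-when : ∀ a₁ b₁ → Unique (when (b₁ ≟ a₁ * c) (map (a₁ ∷_) (solutions cs (a ∸ a₁) (b ∸ b₁))))
  unique-when a₁ b₁ with b₁ ≟ a₁ * c
  ... | yes _ = Unique.map⁺ ∷-injectiveʳ (solutions-unique cs (a ∸ a₁) (b ∸ b₁))
  ... | no _ = []
  separated : ∀ a₁ a₁′ z → z ∈ _ → z ∈ _ → a₁ ≡ a₁′
  separated a₁ a₁′ z p q with ∈-concatMap⁻ _ (upTo (suc b)) p | ∈-concatMap⁻ _ (upTo (suc b)) q
  ... | b₁ , _ , p′ | b₁′ , _ , q′ with ∈-when⁻ {c} {a₁} {b₁} p′ | ∈-when⁻ {c} {a₁′} {b₁′} q′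
  ... | _ , _ , refl , _ | _ , _ , z≡ , _ = ∷-injectiveˡ z≡

fromFun : ∀ {d} {ns : Vec ℕ d} → (Idx ns → ℕ) → Array ns
fromFun {ns = []} g = g tt
fromFun {ns = n ∷ ns} g = Vec.tabulate (λ a → fromFun (λ is → g (a , is)))

get-fromFun : ∀ {d} {ns : Vec ℕ d} (g : Idx ns → ℕ) i → get (fromFun {ns = ns} g) i ≡ g i
get-fromFun {ns = []} g tt = refl
get-fromFun {ns = n ∷ ns} g (a , is) =
  trans (cong (λ v → get v is) (Vec.lookup∘tabulate _ a)) (get-fromFun (λ is → g (a , is)) is)

get-ext : ∀ {d} {ns : Vec ℕ d} (π π′ : Array ns) → (∀ i → get π i ≡ get π′ i) → π ≡ π′
get-ext {ns = []} π π′ π≗π′ = π≗π′ tt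
get-ext {ns = n ∷ ns} π π′ π≗π′ =
  trans (sym (Vec.tabulate∘lookup π))
   (trans (Vec.tabulate-cong (λ a → get-ext (lookup π a) (lookup π′ a) (λ is → π≗π′ (a , is))))
          (Vec.tabulate∘lookup π′))

∈-allIdx : ∀ {d} (ns : Vec ℕ d) (i : Idx ns) → i ∈ allIdx ns
∈-allIdx [] tt = here refl
∈-allIdx (n ∷ ns) (a , is) =
  ∈-concatMap⁺ (λ i → map (i ,_) (allIdx ns)) (∈-allFin a) (∈-map⁺ (a ,_) (∈-allIdx ns is))

length-allIdx-∷ : ∀ {d} n (ns : Vec ℕ d) → length (allIdx (n ∷ ns)) ≡ n * length (allIdx ns)
length-allIdx-∷ n ns =
  begin
    length (allIdx (n ∷ ns))
  ≡⟨ length-concatMap (λ i → map (i ,_) (allIdx ns)) (allFin n) ⟩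
    sum (map (λ i → length (map (i ,_) (allIdx ns))) (allFin n))
  ≡⟨ cong sum (map-cong (λ i → length-map (i ,_) (allIdx ns)) (allFin n)) ⟩
    sum (map (λ _ → length (allIdx ns)) (allFin n))
  ≡⟨ sum-map-const (length (allIdx ns)) (allFin n) ⟩
    length (allFin n) * length (allIdx ns)
  ≡⟨ cong (_* length (allIdx ns)) (length-tabulate {n = n} (λ i → i)) ⟩
    n * length (allIdx ns)
  ∎
  where open ≡-Reasoning

flatten : ∀ {d} {ns : Vec ℕ d} → Array ns → List ℕ
flatten {ns = ns} π = map (get π) (allIdx ns)

chunks : ∀ {A : Set} → (List ℕ → A) → ℕ → (k : ℕ) → List ℕ → Vec A k
chunks f s zero _ = []
chunks f s (suc k) m = f (take s m) ∷ chunks f s k (drop s m)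

-- Inverse of flatten on lists of the right length (flatten-unflatten); junk otherwise.
unflatten : ∀ {d} (ns : Vec ℕ d) → List ℕ → Array ns
unflatten [] [] = 0
unflatten [] (x ∷ _) = x
unflatten (n ∷ ns) m = chunks (unflatten ns) (length (allIdx ns)) n m

flatten-∷ : ∀ {d} {n} {ns : Vec ℕ d} (v : Array (n ∷ ns)) →
  flatten v ≡ concatMap (λ i → flatten (lookup v i)) (allFin n)
flatten-∷ {n = n} {ns} v =
  trans (map-concatMap (get v) (λ i → map (i ,_) (allIdx ns)) (allFin n))
        (cong concat (map-cong (λ i → sym (map-∘ (allIdx ns))) (allFin n)))

flatten-unflatten : ∀ {d} (ns : Vec ℕ d) m → length m ≡ length (allIdx ns) → flatten (unflatten ns m) ≡ m
flatten-unflatten [] (x ∷ []) _ = refl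
flatten-unflatten (n ∷ ns) m len =
  trans (flatten-∷ (unflatten (n ∷ ns) m)) (flatten-chunks n m (trans len (length-allIdx-∷ n ns)))
  where
  s : ℕ
  s = length (allIdx ns)
  flatten-chunks : ∀ k m → length m ≡ k * s →
    concatMap (λ i → flatten (lookup (chunks (unflatten ns) s k m) i)) (allFin k) ≡ m
  flatten-chunks zero [] _ = refl
  flatten-chunks (suc k) m len′ =
    begin
      concatMap chunk (zero ∷ tabulate suc)
    ≡⟨ cong (λ is → flatten (unflatten ns (take s m)) ++ concat is)
            (trans (cong (map chunk) (sym (map-tabulate (λ i → i) suc))) (sym (map-∘ (allFin k)))) ⟩
      flatten (unflatten ns (take s m)) ++ concatMap (chunk ∘ suc) (allFin k)
    ≡⟨ cong₂ _++_ (flatten-unflatten ns (take s m) take-length) (flatten-chunks k (drop s m) drop-length) ⟩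
      take s m ++ drop s m
    ≡⟨ take++drop≡id s m ⟩
      m
    ∎
    where
    open ≡-Reasoning
    chunk : Fin (suc k) → List ℕ
    chunk i = flatten (lookup (chunks (unflatten ns) s (suc k) m) i)
    take-length : length (take s m) ≡ s
    take-length = trans (length-take s m) (trans (cong (s ⊓_) len′) (m≤n⇒m⊓n≡m (m≤m+n s (k * s))))
    drop-length : length (drop s m) ≡ k * s
    drop-length = trans (length-drop s m) (trans (cong (_∸ s) len′) (m+n∸m≡n s (k * s)))

maxFin : ∀ {d} → (Fin d → ℕ) → ℕ
maxFin {zero} f = 0
maxFin {suc d} f = f zero ⊔ maxFin (f ∘ suc)

maxFin-ub : ∀ {d} (f : Fin d → ℕ) ℓ → f ℓ ≤ maxFin f
maxFin-ub f zero = m≤m⊔n (f zero) _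
maxFin-ub f (suc ℓ) = ≤-trans (maxFin-ub (f ∘ suc) ℓ) (m≤n⊔m (f zero) _)

maxFin-lub : ∀ {d} (f : Fin d → ℕ) {x} → (∀ ℓ → f ℓ ≤ x) → maxFin f ≤ x
maxFin-lub {zero} f _ = z≤n
maxFin-lub {suc d} f f≤x = ⊔-lub (f≤x zero) (maxFin-lub (f ∘ suc) (f≤x ∘ suc))

maxFin-cong : ∀ {d} {f g : Fin d → ℕ} → (∀ ℓ → f ℓ ≡ g ℓ) → maxFin f ≡ maxFin g
maxFin-cong {zero} _ = refl
maxFin-cong {suc d} f≗g = cong₂ _⊔_ (f≗g zero) (maxFin-cong (f≗g ∘ suc))

-- The k ∈ [1, v] lying strictly above every f ℓ are those in (maxFin f, v].
length-filter-aboveAll : ∀ {d} (f : Fin d → ℕ) v →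
  length (filter (λ k → all? (λ ℓ → f ℓ <? k)) (map suc (upTo v))) ≡ v ∸ maxFin f
length-filter-aboveAll f zero = sym (0∸n≡0 (maxFin f))
length-filter-aboveAll f (suc v) =
  begin
    length (filter P? (map suc (upTo (suc v))))
  ≡⟨ cong (λ xs → length (filter P? (map suc xs))) (sym (upTo-∷ʳ v)) ⟩
    length (filter P? (map suc (upTo v ∷ʳ v)))
  ≡⟨ cong (length ∘ filter P?) (map-++ suc (upTo v) [ v ]) ⟩
    length (filter P? (map suc (upTo v) ++ [ suc v ]))
  ≡⟨ cong length (filter-++ P? (map suc (upTo v)) [ suc v ]) ⟩
    length (filter P? (map suc (upTo v)) ++ filter P? [ suc v ])
  ≡⟨ length-++ (filter P? (map suc (upTo v))) ⟩
    length (filter P? (map suc (upTo v))) + length (filter P? [ suc v ])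
  ≡⟨ cong (_+ length (filter P? [ suc v ])) (length-filter-aboveAll f v) ⟩
    (v ∸ M) + length (filter P? [ suc v ])
  ≡⟨ last-step ⟩
    suc v ∸ M
  ∎
  where
  open ≡-Reasoning
  M : ℕ
  M = maxFin f
  P? : ∀ k → Dec (∀ ℓ → f ℓ < k)
  P? k = all? (λ ℓ → f ℓ <? k)
  last-step : (v ∸ M) + length (filter P? [ suc v ]) ≡ suc v ∸ M
  last-step with M ≤? v
  ... | yes M≤v =
    trans (cong (λ xs → (v ∸ M) + length xs) (filter-accept P? (λ ℓ → s≤s (≤-trans (maxFin-ub f ℓ) M≤v))))
          (trans (+-comm (v ∸ M) 1) (sym (+-∸-assoc 1 M≤v)))
  ... | no M≰v =
    trans (cong₂ _+_ (m≤n⇒m∸n≡0 (<⇒≤ (≰⇒> M≰v)))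
                     (cong length (filter-reject P? (λ all< → M≰v (maxFin-lub f (s≤s⁻¹ ∘ all<))))))
          (sym (m≤n⇒m∸n≡0 (≰⇒> M≰v)))

nbrMax : ∀ {d} {ns : Vec ℕ d} → (Idx ns → ℕ) → Idx ns → ℕ
nbrMax h i = maxFin (λ ℓ → maybe′ h 0 (step ℓ i))

_⋖_ : ∀ {d} {ns : Vec ℕ d} → Idx ns → Idx ns → Set
_⋖_ {d} i j = ∃ λ (ℓ : Fin d) → step ℓ i ≡ just j

nbrMax-cong : ∀ {d} {ns : Vec ℕ d} {h h′ : Idx ns → ℕ} i →
  (∀ j → i ⋖ j → h j ≡ h′ j) → nbrMax h i ≡ nbrMax h′ i
nbrMax-cong {h = h} {h′} i h≗h′ = maxFin-cong λ ℓ → at ℓ (step ℓ i) refl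
  where
  at : ∀ ℓ x → step ℓ i ≡ x → maybe′ h 0 x ≡ maybe′ h′ 0 x
  at ℓ (just j) eq = h≗h′ j (ℓ , eq)
  at ℓ nothing _ = refl

nbrMax-ub : ∀ {d} {ns : Vec ℕ d} (h : Idx ns → ℕ) {i j} → i ⋖ j → h j ≤ nbrMax h i
nbrMax-ub h {i} (ℓ , eq) = subst (λ x → maybe′ h 0 x ≤ nbrMax h i) eq (maxFin-ub _ ℓ)

nbrMax-lub : ∀ {d} {ns : Vec ℕ d} (h : Idx ns → ℕ) i {x} → (∀ j → i ⋖ j → h j ≤ x) → nbrMax h i ≤ x
nbrMax-lub h i {x} h≤x = maxFin-lub _ λ ℓ → at ℓ (step ℓ i) refl
  where
  at : ∀ ℓ y → step ℓ i ≡ y → maybe′ h 0 y ≤ x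
  at ℓ (just j) eq = h≤x j (ℓ , eq)
  at ℓ nothing _ = z≤n

getM≡maybe : ∀ {d} {ns : Vec ℕ d} (π : Array ns) x → getM π x ≡ maybe′ (get π) 0 x
getM≡maybe π (just i) = refl
getM≡maybe π nothing = refl

cornersAt≡ : ∀ {d} {ns : Vec ℕ d} (π : Array ns) i → cornersAt π i ≡ get π i ∸ nbrMax (get π) i
cornersAt≡ π i =
  trans (length-filter-aboveAll (λ ℓ → getM π (step ℓ i)) (get π i))
        (cong (get π i ∸_) (maxFin-cong λ ℓ → getM≡maybe π (step ℓ i)))

rankFin : ∀ {n} → Fin n → ℕ
rankFin {suc n} zero = n
rankFin {suc n} (suc a) = rankFin a

-- Distance to the far corner of the box; it drops by one along ⋖.
rank : ∀ {d} {ns : Vec ℕ d} → Idx ns → ℕ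
rank {ns = []} tt = 0
rank {ns = n ∷ ns} (a , is) = rankFin a + rank is

rankFin≤ : ∀ {n} (a : Fin n) → rankFin a ≤ n
rankFin≤ {suc n} zero = n≤1+n n
rankFin≤ {suc n} (suc a) = ≤-trans (rankFin≤ a) (n≤1+n n)

rank≤sum : ∀ {d} {ns : Vec ℕ d} (i : Idx ns) → rank i ≤ Vec.sum ns
rank≤sum {ns = []} tt = z≤n
rank≤sum {ns = n ∷ ns} (a , is) = +-mono-≤ (rankFin≤ a) (rank≤sum is)

rankFin-nextFin : ∀ {n} (a b : Fin n) → nextFin a ≡ just b → suc (rankFin b) ≡ rankFin a
rankFin-nextFin {suc (suc n)} zero .(suc zero) refl = refl
rankFin-nextFin {suc (suc n)} (suc a) b eq with nextFin a in e
rankFin-nextFin {suc (suc n)} (suc a) .(suc b′) refl | just b′ = rankFin-nextFin a b′ e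

toℕ-nextFin : ∀ {n} (a b : Fin n) → nextFin a ≡ just b → toℕ a ≤ toℕ b
toℕ-nextFin {suc (suc n)} zero .(suc zero) refl = z≤n
toℕ-nextFin {suc (suc n)} (suc a) b eq with nextFin a in e
toℕ-nextFin {suc (suc n)} (suc a) .(suc b′) refl | just b′ = s≤s (toℕ-nextFin a b′ e)

rank-step : ∀ {d} {ns : Vec ℕ d} ℓ (i j : Idx ns) → step ℓ i ≡ just j → suc (rank j) ≡ rank i
rank-step {ns = n ∷ ns} zero (a , is) j eq with nextFin a in e
rank-step {ns = n ∷ ns} zero (a , is) .(b , is) refl | just b = cong (_+ rank is) (rankFin-nextFin a b e)
rank-step {ns = n ∷ ns} (suc ℓ) (a , is) j eq with step ℓ is in e
rank-step {ns = n ∷ ns} (suc ℓ) (a , is) .(a , js) refl | just js =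
  trans (sym (+-suc (rankFin a) (rank js))) (cong (rankFin a +_) (rank-step ℓ is js e))

rank-⋖ : ∀ {d} {ns : Vec ℕ d} {i j : Idx ns} → i ⋖ j → rank j < rank i
rank-⋖ {i = i} {j} (ℓ , eq) = ≤-reflexive (rank-step ℓ i j eq)

≤ᵢ-refl : ∀ {d} {ns : Vec ℕ d} (i : Idx ns) → i ≤ᵢ i
≤ᵢ-refl {ns = []} tt = tt
≤ᵢ-refl {ns = n ∷ ns} (a , is) = ≤-refl , ≤ᵢ-refl is

step⇒≤ᵢ : ∀ {d} {ns : Vec ℕ d} ℓ (i j : Idx ns) → step ℓ i ≡ just j → i ≤ᵢ j
step⇒≤ᵢ {ns = n ∷ ns} zero (a , is) j eq with nextFin a in e
step⇒≤ᵢ {ns = n ∷ ns} zero (a , is) .(b , is) refl | just b = toℕ-nextFin a b e , ≤ᵢ-refl is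
step⇒≤ᵢ {ns = n ∷ ns} (suc ℓ) (a , is) j eq with step ℓ is in e
step⇒≤ᵢ {ns = n ∷ ns} (suc ℓ) (a , is) .(a , js) refl | just js = ≤-refl , step⇒≤ᵢ ℓ is js e

⋖⇒≤ᵢ : ∀ {d} {ns : Vec ℕ d} {i j : Idx ns} → i ⋖ j → i ≤ᵢ j
⋖⇒≤ᵢ {i = i} {j} (ℓ , eq) = step⇒≤ᵢ ℓ i j eq

antitone-nextFin : ∀ {n} (h : Fin n → ℕ) → (∀ x y → nextFin x ≡ just y → h y ≤ h x) →
  ∀ a b → toℕ a ≤ toℕ b → h b ≤ h a
antitone-nextFin h h↓ zero zero _ = ≤-refl
antitone-nextFin {suc (suc n)} h h↓ zero (suc b) _ =
  ≤-trans (antitone-nextFin (h ∘ suc) (λ x y eq → h↓ (suc x) (suc y) (cong (Maybe.map suc) eq)) zero b z≤n)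
          (h↓ zero (suc zero) refl)
antitone-nextFin {suc (suc n)} h h↓ (suc a) (suc b) (s≤s a≤b) =
  antitone-nextFin (h ∘ suc) (λ x y eq → h↓ (suc x) (suc y) (cong (Maybe.map suc) eq)) a b a≤b

antitone-⋖ : ∀ {d} {ns : Vec ℕ d} (h : Idx ns → ℕ) → (∀ {i j} → i ⋖ j → h j ≤ h i) →
  ∀ i j → i ≤ᵢ j → h j ≤ h i
antitone-⋖ {ns = []} h _ tt tt _ = ≤-refl
antitone-⋖ {ns = n ∷ ns} h h↓ (a , is) (b , js) (a≤b , is≤js) =
  ≤-trans (antitone-nextFin (λ x → h (x , js)) first a b a≤b)
          (antitone-⋖ (λ x → h (a , x)) rest is js is≤js)
  where
  first : ∀ x y → nextFin x ≡ just y → h (y , js) ≤ h (x , js)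
  first x y eq = h↓ (zero , cong (Maybe.map (_, js)) eq)
  rest : ∀ {x y} → x ⋖ y → h (a , y) ≤ h (a , x)
  rest (ℓ , eq) = h↓ (suc ℓ , cong (Maybe.map (a ,_)) eq)

-- Reconstructing a partition from its corner counts

-- Iterates h ↦ g + nbrMax h; as rank drops along ⋖, k rounds settle every i of rank < k.
approx : ∀ {d} {ns : Vec ℕ d} → ℕ → (Idx ns → ℕ) → Idx ns → ℕ
approx zero g i = 0
approx (suc k) g i = g i + nbrMax (approx k g) i

approx-unique : ∀ {d} {ns : Vec ℕ d} (g h : Idx ns → ℕ) → (∀ i → h i ≡ g i + nbrMax h i) →
  ∀ k i → rank i < k → approx k g i ≡ h i
approx-unique g h h-eq (suc k) i i<k =
  trans (cong (g i +_) (nbrMax-cong i λ j i⋖j →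
          approx-unique g h h-eq k j (≤-trans (rank-⋖ i⋖j) (s≤s⁻¹ i<k))))
        (sym (h-eq i))

approx-stable : ∀ {d} {ns : Vec ℕ d} (g : Idx ns → ℕ) k i → rank i < k → approx k g i ≡ approx (suc k) g i
approx-stable g (suc k) i i<k =
  cong (g i +_) (nbrMax-cong i λ j i⋖j → approx-stable g k j (≤-trans (rank-⋖ i⋖j) (s≤s⁻¹ i<k)))

stack : ∀ {d} {ns : Vec ℕ d} → (Idx ns → ℕ) → Idx ns → ℕ
stack {ns = ns} = approx (suc (Vec.sum ns))

stack-eq : ∀ {d} {ns : Vec ℕ d} (g : Idx ns → ℕ) i → stack g i ≡ g i + nbrMax (stack g) i
stack-eq {ns = ns} g i =
  cong (g i +_) (nbrMax-cong i λ j i⋖j →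
    approx-stable g (Vec.sum ns) j (≤-trans (rank-⋖ i⋖j) (rank≤sum i)))

stack-unique : ∀ {d} {ns : Vec ℕ d} (g h : Idx ns → ℕ) → (∀ i → h i ≡ g i + nbrMax h i) →
  ∀ i → stack g i ≡ h i
stack-unique {ns = ns} g h h-eq i = approx-unique g h h-eq _ i (s≤s (rank≤sum i))

isPartition-fromFun-stack : ∀ {d} {ns : Vec ℕ d} (g : Idx ns → ℕ) → IsPartition (fromFun {ns = ns} (stack g))
isPartition-fromFun-stack g i j i≤j =
  subst₂ _≤_ (sym (get-fromFun (stack g) j)) (sym (get-fromFun (stack g) i))
    (antitone-⋖ (stack g) stack↓ i j i≤j)
  where
  stack↓ : ∀ {i j} → i ⋖ j → stack g j ≤ stack g i
  stack↓ {i} i⋖j = ≤-trans (nbrMax-ub (stack g) i⋖j)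
                           (≤-trans (m≤n+m _ (g i)) (≤-reflexive (sym (stack-eq g i))))

cornersAt-fromFun-stack : ∀ {d} {ns : Vec ℕ d} (g : Idx ns → ℕ) i → cornersAt (fromFun {ns = ns} (stack g)) i ≡ g i
cornersAt-fromFun-stack g i =
  begin
    cornersAt (fromFun (stack g)) i
  ≡⟨ cornersAt≡ (fromFun (stack g)) i ⟩
    get (fromFun (stack g)) i ∸ nbrMax (get (fromFun (stack g))) i
  ≡⟨ cong₂ _∸_ (get-fromFun (stack g) i) (nbrMax-cong i λ j _ → get-fromFun (stack g) j) ⟩
    stack g i ∸ nbrMax (stack g) i
  ≡⟨ cong (_∸ nbrMax (stack g) i) (stack-eq g i) ⟩
    g i + nbrMax (stack g) i ∸ nbrMax (stack g) i
  ≡⟨ m+n∸n≡m (g i) (nbrMax (stack g) i) ⟩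
    g i
  ∎
  where open ≡-Reasoning

get≡cornersAt+nbrMax : ∀ {d} {ns : Vec ℕ d} (π : Array ns) → IsPartition π →
  ∀ i → get π i ≡ cornersAt π i + nbrMax (get π) i
get≡cornersAt+nbrMax π π↓ i =
  trans (sym (m∸n+n≡m nbrMax≤get)) (cong (_+ nbrMax (get π) i) (sym (cornersAt≡ π i)))
  where
  nbrMax≤get : nbrMax (get π) i ≤ get π i
  nbrMax≤get = nbrMax-lub (get π) i λ j i⋖j → π↓ i j (⋖⇒≤ᵢ i⋖j)

cornerList : ∀ {d} {ns : Vec ℕ d} → Array ns → List ℕ
cornerList {ns = ns} π = map (cornersAt π) (allIdx ns)

fromCorners : ∀ {d} (ns : Vec ℕ d) → List ℕ → Array ns
fromCorners ns m = fromFun (stack (get (unflatten ns m)))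

length-cornerList : ∀ {d} {ns : Vec ℕ d} (π : Array ns) → length (cornerList π) ≡ length (allIdx ns)
length-cornerList {ns = ns} π = length-map (cornersAt π) (allIdx ns)

isPartition-fromCorners : ∀ {d} (ns : Vec ℕ d) m → IsPartition (fromCorners ns m)
isPartition-fromCorners ns m = isPartition-fromFun-stack (get (unflatten ns m))

cornerList-fromCorners : ∀ {d} (ns : Vec ℕ d) m → length m ≡ length (allIdx ns) →
  cornerList (fromCorners ns m) ≡ m
cornerList-fromCorners ns m len =
  trans (map-cong (cornersAt-fromFun-stack (get (unflatten ns m))) (allIdx ns))
        (flatten-unflatten ns m len)

fromCorners-cornerList : ∀ {d} {ns : Vec ℕ d} (π : Array ns) → IsPartition π →
  fromCorners ns (cornerList π) ≡ π
fromCorners-cornerList {ns = ns} π π↓ = get-ext _ π λ i →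
  trans (get-fromFun (stack g) i) (stack-unique g (get π) get-eq i)
  where
  g : Idx ns → ℕ
  g = get (unflatten ns (cornerList π))
  g≡cornersAt : ∀ i → g i ≡ cornersAt π i
  g≡cornersAt i = map-≡⇒≡-∈ (allIdx ns) (flatten-unflatten ns (cornerList π) (length-cornerList π)) (∈-allIdx ns i)
  get-eq : ∀ i → get π i ≡ g i + nbrMax (get π) i
  get-eq i = trans (get≡cornersAt+nbrMax π π↓ i) (cong (_+ nbrMax (get π) i) (sym (g≡cornersAt i)))

chWeights : ∀ {d} (ns : Vec ℕ d) → List ℕ
chWeights ns = map ch (allIdx ns)

length-chWeights : ∀ {d} (ns : Vec ℕ d) → length (chWeights ns) ≡ length (allIdx ns)
length-chWeights ns = length-map ch (allIdx ns)

chWeight≡dot : ∀ {d} {ns : Vec ℕ d} (π : Array ns) → chWeight π ≡ dot (chWeights ns) (cornerList π)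
chWeight≡dot {ns = ns} π = sym (dot-map ch (cornersAt π) (allIdx ns))

Counted : ∀ {d} {ns : Vec ℕ d} → ℕ → ℕ → Array ns → Set
Counted a b π = IsPartition π × cor π ≡ a × chWeight π ≡ b

fromCorners-counted : ∀ {d} (ns : Vec ℕ d) {a b m} → IsSolution (chWeights ns) a b m → Counted a b (fromCorners ns m)
fromCorners-counted ns {m = m} (len , Σm≡a , dot≡b) =
  isPartition-fromCorners ns m ,
  trans (cong sum cornerList≡m) Σm≡a ,
  trans (chWeight≡dot (fromCorners ns m)) (trans (cong (dot (chWeights ns)) cornerList≡m) dot≡b)
  where
  cornerList≡m : cornerList (fromCorners ns m) ≡ m
  cornerList≡m = cornerList-fromCorners ns m (trans len (length-chWeights ns))

cornerList-isSolution : ∀ {d} {ns : Vec ℕ d} {a b} (π : Array ns) → Counted a b π →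
  IsSolution (chWeights ns) a b (cornerList π)
cornerList-isSolution {ns = ns} π (_ , cor≡a , chWeight≡b) =
  trans (length-cornerList π) (sym (length-chWeights ns)) , cor≡a , trans (sym (chWeight≡dot π)) chWeight≡b

corollary5p3 : (d : ℕ) → 1 ≤ d → (ns : Vec ℕ d) → ((k : Fin d) → 1 ≤ lookup ns k) →
    (a b : ℕ) →
    Σ (List (Array ns)) (λ L →
      Unique L ×
      ((π : Array ns) → (π ∈ L) ⇔ (IsPartition π × cor π ≡ a × chWeight π ≡ b)) ×
      length L ≡ rhsSeries ns a b)
corollary5p3 d _ ns _ a b = L , proj₁ enumeration , proj₂ enumeration , length-L
  where
  L : List (Array ns)
  L = map (fromCorners ns) (solutions (chWeights ns) a b)
  enumeration : Unique L × (∀ π → π ∈ L ⇔ Counted a b π)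
  enumeration = enumeration-map (fromCorners ns) cornerList
    (λ (len , _) → cornerList-fromCorners ns _ (trans len (length-chWeights ns)))
    (λ (π↓ , _) → fromCorners-cornerList _ π↓)
    (fromCorners-counted ns) (cornerList-isSolution _)
    (solutions (chWeights ns) a b) (solutions-unique (chWeights ns) a b) (∈-solutions (chWeights ns) a b)
  length-L : length L ≡ rhsSeries ns a b
  length-L = begin
    length L                                    ≡⟨ length-map _ (solutions (chWeights ns) a b) ⟩
    length (solutions (chWeights ns) a b)       ≡⟨ length-solutions (chWeights ns) a b ⟩
    prodS (map geomInv (chWeights ns)) a b      ≡⟨ cong (λ fs → prodS fs a b) (sym (map-∘ (allIdx ns))) ⟩
    rhsSeries ns a b                            ∎
    where open ≡-Reasoning
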